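{- Consider the knight configuration (squares given as (column, row)) with a knight of budget $0$ on $(1,3)$ and knights of budget $2$ on $(3,2),(3,4),(5,1),(7,2),(9,1)$, and additionally either (a) a knight of budget $2$ on $(1,1)$ (input signal $(1,0)$), or (b) no piece on $(1,1)$ (input signal $(0,0)$). In case (a) there is a capturing sequence after which exactly one piece remains; in case (b) there is no capturing sequence after which exactly one piece remains.
   Context: Knights capture as follows: a piece with positive budget on $(x,y)$ may capture a piece on $(x',y')$ with $\{|x-x'|,|y-y'|\}=\{1,2\}$, moving there, removing the captured piece, and losing 1 budget; every move is a capture. -}

module Defs where

open import Data.Nat using (ℕ; zero; suc; _∸_)
open import Data.Product using (_×_; _,_)
open import Data.Sum using (_⊎_)
open import Data.List using (List; []; _∷_)
open import Data.List.Relation.Binary.Permutation.Propositional using (_↭_)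
open import Relation.Binary.PropositionalEquality using (_≡_)
open import Relation.Binary.Construct.Closure.ReflexiveTransitive using (Star)

∣_-_∣ : ℕ → ℕ → ℕ
∣ a - b ∣ = (a ∸ b) Data.Nat.+ (b ∸ a)

record Piece : Set where
  constructor knight
  field
    col    : ℕ
    row    : ℕ
    budget : ℕ
open Piece public

-- a configuration: the multiset of pieces (as a list, considered up to permutation)
Config : Set
Config = List Piece

KnightMove : ℕ → ℕ → ℕ → ℕ → Set
KnightMove x y x' y' =
  (∣ x - x' ∣ ≡ 1 × ∣ y - y' ∣ ≡ 2) ⊎ (∣ x - x' ∣ ≡ 2 × ∣ y - y' ∣ ≡ 1)

data Capture : Config → Config → Set where
  capture : ∀ {c rest} (x y b x' y' b' : ℕ) →
            c ↭ (knight x y (suc b) ∷ knight x' y' b' ∷ rest) →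
            KnightMove x y x' y' →
            Capture c (knight x' y' b ∷ rest)

Captures : Config → Config → Set
Captures = Star Capture

SolvableToOne : Config → Set
SolvableToOne c = Data.Product.∃ λ p → Captures c (p ∷ [])

base : Config
base = knight 1 3 0 ∷ knight 3 2 2 ∷ knight 3 4 2 ∷ knight 5 1 2
     ∷ knight 7 2 2 ∷ knight 9 1 2 ∷ []

configA : Config
configA = knight 1 1 2 ∷ base

configB : Config
configB = base

{-# OPTIONS --safe #-}
-- A capture removes a piece, so from a configuration of n + 1 pieces every
-- capturing sequence ending in a single piece has exactly n steps, and the
-- successors of a configuration under one capture form a finite list up to
-- permutation.  Exhaustive search is therefore a decision procedure, and
-- running it settles both cases.  In case (a) it finds, for instance,
-- (3,4)×(1,3), (1,3)×(3,2), (1,1)×(3,2), (3,2)×(5,1), (9,1)×(7,2), (7,2)×(5,1).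
module Submission where

open import Defs
open import Data.Product using (_×_; ∃-syntax; _,_; uncurry)
open import Relation.Nullary using (¬_; Dec; yes; no; contradiction)

open import Data.Bool using (Bool; true; false; T)
open import Data.Nat using (ℕ; zero; suc; _≟_)
open import Data.Nat.Properties using (suc-injective)
open import Data.Unit using (tt)
open import Data.Bool.ListAction using (any)
open import Data.List using (List; []; _∷_; [_]; map; concatMap; length)
open import Data.List.Membership.Propositional using (_∈_; find; lose)
open import Data.List.Membership.Propositional.Properties
  using (∈-map⁺; ∈-map⁻; ∈-concatMap⁺; ∈-concatMap⁻)
open import Data.List.Relation.Unary.Any using (here; there)
open import Data.List.Relation.Unary.Any.Properties using (any⁺; any⁻)
open import Data.List.Relation.Binary.Permutation.Propositional
  using (_↭_; ↭-refl; ↭-sym; ↭-trans; prep; swap)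
open import Data.List.Relation.Binary.Permutation.Propositional.Properties
  using (↭-length; ↭-singleton-inv; drop-∷; ∈-resp-↭)
open import Relation.Binary.PropositionalEquality using (_≡_; refl; sym; trans)
open import Relation.Binary.Construct.Closure.ReflexiveTransitive using (ε; _◅_)
open import Relation.Nullary.Decidable using (_×-dec_; _⊎-dec_)

select : {A : Set} → List A → List (A × List A)
select []       = []
select (x ∷ xs) = (x , xs) ∷ map (λ (y , ys) → y , x ∷ ys) (select xs)

select-sound : {A : Set} {y : A} {xs zs : List A} →
               (y , zs) ∈ select xs → xs ↭ y ∷ zs
select-sound {xs = x ∷ xs} (here refl) = ↭-refl
select-sound {xs = x ∷ xs} (there m) with ∈-map⁻ _ m
... | (y , ys) , m′ , refl = ↭-trans (prep x (select-sound m′)) (swap x y ↭-refl)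

∈⇒∈-select : {A : Set} {y : A} {xs : List A} →
             y ∈ xs → ∃[ zs ] ((y , zs) ∈ select xs × xs ↭ y ∷ zs)
∈⇒∈-select {xs = x ∷ xs} (here refl) = xs , here refl , ↭-refl
∈⇒∈-select {y = y} {xs = x ∷ xs} (there m) with ∈⇒∈-select m
... | zs , m′ , p =
  x ∷ zs , there (∈-map⁺ _ m′) , ↭-trans (prep x p) (swap x y ↭-refl)

select-complete : {A : Set} {y : A} {xs ys : List A} →
                  xs ↭ y ∷ ys → ∃[ zs ] ((y , zs) ∈ select xs × ys ↭ zs)
select-complete p with ∈⇒∈-select (∈-resp-↭ (↭-sym p) (here refl))
... | zs , m , q = zs , m , drop-∷ (↭-trans (↭-sym p) q)

knightMove? : ∀ x y x′ y′ → Dec (KnightMove x y x′ y′)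
knightMove? x y x′ y′ =
  (∣ x - x′ ∣ ≟ 1 ×-dec ∣ y - y′ ∣ ≟ 2) ⊎-dec (∣ x - x′ ∣ ≟ 2 ×-dec ∣ y - y′ ∣ ≟ 1)

Capture-resp-↭ : ∀ {c c′ d} → c ↭ c′ → Capture c d → Capture c′ d
Capture-resp-↭ c↭c′ (capture x y b x′ y′ b′ p k) =
  capture x y b x′ y′ b′ (↭-trans (↭-sym c↭c′) p) k

Captures-resp-↭ : ∀ {c c′ p} → c ↭ c′ → Captures c [ p ] → Captures c′ [ p ]
Captures-resp-↭ c↭c′ ε rewrite ↭-singleton-inv (↭-sym c↭c′) = ε
Captures-resp-↭ c↭c′ (step ◅ steps) = Capture-resp-↭ c↭c′ step ◅ steps

capture-length : ∀ {c d} → Capture c d → length c ≡ suc (length d)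
capture-length (capture _ _ _ _ _ _ p _) = ↭-length p

capturesBy : Piece → Piece → Config → List Config
capturesBy (knight x y zero)    _                 _    = []
capturesBy (knight x y (suc b)) (knight x′ y′ _) rest with knightMove? x y x′ y′
... | yes _ = [ knight x′ y′ b ∷ rest ]
... | no  _ = []

capturesBy-sound : ∀ {p q rest d} → d ∈ capturesBy p q rest → Capture (p ∷ q ∷ rest) d
capturesBy-sound {knight x y (suc b)} {knight x′ y′ b′} m with knightMove? x y x′ y′
capturesBy-sound {knight x y (suc b)} {knight x′ y′ b′} (here refl) | yes k =
  capture x y b x′ y′ b′ ↭-refl k

capturesBy-complete : ∀ {x y b x′ y′ b′ rest} → KnightMove x y x′ y′ →
  knight x′ y′ b ∷ rest ∈ capturesBy (knight x y (suc b)) (knight x′ y′ b′) rest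
capturesBy-complete {x} {y} {b} {x′} {y′} k with knightMove? x y x′ y′
... | yes _ = here refl
... | no ¬k = contradiction k ¬k

capturesByIn : Piece → Config → List Config
capturesByIn p r = concatMap (uncurry (capturesBy p)) (select r)

captures : Config → List Config
captures c = concatMap (uncurry capturesByIn) (select c)

captures-sound : ∀ {c d} → d ∈ captures c → Capture c d
captures-sound m
  with (p , r) , pr∈ , m′ ← find (∈-concatMap⁻ (uncurry capturesByIn) m)
  with (q , rest) , qr∈ , m″ ← find (∈-concatMap⁻ (uncurry (capturesBy p)) m′) =
  Capture-resp-↭ (↭-sym (↭-trans (select-sound pr∈) (prep p (select-sound qr∈))))
                 (capturesBy-sound m″)

captures-complete : ∀ {c d} → Capture c d → ∃[ s ] (s ∈ captures c × d ↭ s)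
captures-complete (capture x y b x′ y′ b′ p k)
  with r , pr∈ , qrest↭r ← select-complete p
  with rest′ , qr∈ , rest↭rest′ ← select-complete (↭-sym qrest↭r) =
  knight x′ y′ b ∷ rest′ ,
  ∈-concatMap⁺ (uncurry capturesByIn) (lose pr∈ (∈-concatMap⁺ (uncurry (capturesBy _)) (lose qr∈ (capturesBy-complete {b′ = b′} k)))) ,
  prep _ rest↭rest′

solvableWithin : ℕ → Config → Bool
solvableWithin _       (_ ∷ []) = true
solvableWithin zero    _        = false
solvableWithin (suc n) c        = any (solvableWithin n) (captures c)

solvableWithin-sound : ∀ n c → T (solvableWithin n c) → SolvableToOne c
solvableWithin-sound _       (p ∷ [])      _ = p , ε
solvableWithin-sound zero    []            ()
solvableWithin-sound (suc n) []            ()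
solvableWithin-sound zero    (_ ∷ _ ∷ _)   ()
solvableWithin-sound (suc n) c@(_ ∷ _ ∷ _) h
  with d , d∈ , hd ← find (any⁻ _ _ h)
  with p , steps ← solvableWithin-sound n d hd =
  p , captures-sound d∈ ◅ steps

solvableWithin-complete : ∀ n {c p} → length c ≡ suc n →
                          Captures c [ p ] → T (solvableWithin n c)
solvableWithin-complete _       {_ ∷ []}        _   _ = tt
solvableWithin-complete (suc n) {c@(_ ∷ _ ∷ _)} len (step ◅ steps)
  with s , s∈ , d↭s ← captures-complete step =
  any⁺ _ (lose s∈ (solvableWithin-complete n len′ (Captures-resp-↭ d↭s steps)))
  where
  len′ : length s ≡ suc n
  len′ = trans (sym (↭-length d↭s)) (suc-injective (trans (sym (capture-length step)) len))

lemma17 : SolvableToOne configA × ¬ SolvableToOne configB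
lemma17 = solvableWithin-sound 6 configA tt
        , λ (p , steps) → solvableWithin-complete 5 refl steps
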